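{- Let $\beta\in\mathfrak S_n$ and $k\ge1$. The set of nondecreasing rearrangements of the first $k$ components of the majcodes $\operatorname{Mc}(\sigma)$, for $\sigma\in\operatorname{id}_k\Cup\beta$, is the set of all sequences $(i_1,\ldots,i_k)$ with $0\le i_1\le\cdots\le i_k\le n$. In particular $$\sum_{\sigma\in\operatorname{id}_k\Cup\beta}x_{\operatorname{Mc}(\sigma)}=h_k(X_n)\,x_{\operatorname{Mc}(\beta)}.$$
   Context: Permutations are words. $\operatorname{id}_k\Cup\beta$ is the set of permutations of $[n+k]$ obtained by shuffling the word $12\cdots k$ with the word $(\beta(1)+k)\cdots(\beta(n)+k)$. Majcode: for a word $w=w_1\cdots w_m$, $\operatorname{maj}(w)=\sum_{j:w_j>w_{j+1}}j$; for $\sigma\in\mathfrak S_m$, $\sigma^{(i)}$ is the subword of letters $\ge i$, and $\operatorname{Mc}(\sigma)=(c_1,\ldots,c_m)$ with $c_m=0$ and $c_i=\operatorname{maj}(\sigma^{(i)})-\operatorname{maj}(\sigma^{(i+1)})$. $x_0,x_1,\ldots$ commuting indeterminates, $x_c=x_{c_1}\cdots x_{c_m}$, $X_n=\{x_0,\ldots,x_n\}$, $h_k(X_n)$ the complete homogeneous symmetric polynomial of degree $k$ in $X_n$. -}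

module Defs where

open import Data.Nat as ℕ using (ℕ; zero; suc; _+_; _<ᵇ_; _≤?_)
open import Data.Integer as ℤ using (ℤ; +_; _-_)
open import Data.List using (List; []; _∷_; [_]; map; _++_; filter; upTo; concatMap; length; take)
open import Data.Bool using (if_then_else_)
import Data.List.Relation.Binary.Permutation.Propositional as PermP
import Data.List.Relation.Binary.Permutation.Setoid as PermS

range : ℕ → ℕ → List ℕ
range a zero = []
range a (suc m) = a ∷ range (suc a) m

idWord : ℕ → List ℕ
idWord m = range 1 m

-- β is a permutation of [n] written as a word (one-line notation)
IsPerm : ℕ → List ℕ → Set
IsPerm n β = β PermP.↭ idWord n

shuffle : List ℕ → List ℕ → List (List ℕ)
shuffle [] ys = [ ys ]
shuffle (x ∷ xs) [] = [ x ∷ xs ]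
shuffle (x ∷ xs) (y ∷ ys) =
  map (x ∷_) (shuffle xs (y ∷ ys)) ++ map (y ∷_) (shuffle (x ∷ xs) ys)

shuffleId : ℕ → List ℕ → List (List ℕ)
shuffleId k β = shuffle (idWord k) (map (_+ k) β)

-- maj(w) = Σ_{j : w_j > w_{j+1}} j  (positions 1-indexed)
majFrom : ℕ → List ℕ → ℕ
majFrom j [] = 0
majFrom j (a ∷ []) = 0
majFrom j (a ∷ b ∷ t) = (if b <ᵇ a then j else 0) + majFrom (suc j) (b ∷ t)

maj : List ℕ → ℕ
maj = majFrom 1

subwordGe : ℕ → List ℕ → List ℕ
subwordGe i σ = filter (i ≤?_) σ

mcComp : List ℕ → ℕ → ℤ
mcComp σ i = + maj (subwordGe i σ) - + maj (subwordGe (suc i) σ)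

Mc : List ℕ → List ℤ
Mc σ = map (λ i → if i ℕ.≡ᵇ length σ then + 0 else mcComp σ i) (idWord (length σ))

-- Polynomials with ℕ-coefficients in commuting indeterminates x_j:
-- a monomial x_c = x_{c_1}⋯x_{c_m} is the list c up to permutation,
-- a polynomial is a finite sum of monomials (list of monomials, up to
-- permutation, monomials compared up to permutation).
Monomial : Set
Monomial = List ℤ

Poly : Set
Poly = List Monomial

_≈P_ : Poly → Poly → Set
_≈P_ = PermS._↭_ (PermP.↭-setoid {A = ℤ})

_*M_ : Poly → Monomial → Poly
p *M m = map (_++ m) p

ndSeqs : ℕ → ℕ → ℕ → List (List ℕ)
ndSeqs zero lo n = [ [] ]
ndSeqs (suc k) lo n =
  concatMap (λ j → map (j ∷_) (ndSeqs k j n)) (range lo (suc (n ℕ.∸ lo)))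

hPoly : ℕ → ℕ → Poly
hPoly k n = map (map (λ i → + i)) (ndSeqs k 0 n)

shuffleSum : ℕ → List ℕ → Poly
shuffleSum k β = map Mc (shuffleId k β)

open import Data.List.Relation.Unary.Linked using (Linked)

NonDecreasing : List ℤ → Set
NonDecreasing = Linked ℤ._≤_

IsNondecRearrangement : List ℤ → List ℤ → Set
IsNondecRearrangement s w = NonDecreasing s Data.Product.× (s PermP.↭ w)
  where import Data.Product

-- In σ ∈ id_k ⧢ β the letters 1, …, k lie below all others, so the majcode of σ ends with Mc(β),
-- and its component c_i (i ≤ k) is the increase of maj when the smallest letter i is inserted into
-- σ^(i+1).  Inserting a new smallest letter into the n + 1 slots of a word of length n increases maj
-- by 0, 1, …, n, once each.  More generally, shuffle 1, …, m into the prefix p of a word p q of larger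
-- letters: over all such shuffles, the sorted (c_1, …, c_m) run through the size-m multisets drawn from
-- the increases δ of the slots of p.  This follows by induction on the last letter of the shuffle.  If
-- it is m, it contributes the δ of the last slot and then joins q, which leaves the multiset of the
-- other δ's unchanged; if it is the last letter of p, that letter joins q and p loses its last slot.
-- These two cases are exactly the recursion of multisets of size m + 1 from a list d ∷ L: those that
-- contain d, and those drawn from L.  For q empty and p the shifted β this gives h_k(X_n).

module Submission where

open import Defs
open import Data.Bool using (true; false; if_then_else_; T)
open import Data.Empty using (⊥-elim)
open import Data.Nat as ℕ using (ℕ; zero; suc; _+_; _≥_; _<ᵇ_; _≡ᵇ_; _≤?_)
import Data.Nat.Properties as ℕₚ
open import Data.Nat.Tactic.RingSolver using (solve-∀)
open import Data.Integer as ℤ using (ℤ; +_; _-_; _≤_; +≤+)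
import Data.Integer.Properties as ℤₚ
open import Data.List using (List; []; _∷_; [_]; _++_; _∷ʳ_; map; filter; length; take; reverse; concatMap)
import Data.List.Properties as Listₚ
open import Data.List.Membership.Propositional using (_∈_; find)
import Data.List.Membership.Propositional.Properties as ∈ₚ
open import Data.List.Relation.Unary.All as All using (All; []; _∷_)
import Data.List.Relation.Unary.All.Properties as Allₚ
open import Data.List.Relation.Unary.Any as Any using (here; there)
open import Data.List.Relation.Unary.Linked as Linked using (Linked; []; [-]; _∷_)
import Data.List.Relation.Unary.Linked.Properties as Linkedₚ
open import Data.List.Relation.Binary.Permutation.Propositional as ↭
  using (_↭_; ↭-refl; ↭-sym; ↭-trans; ↭-reflexive; prep; swap; module PermutationReasoning)
import Data.List.Relation.Binary.Permutation.Propositional.Properties as ↭ₚ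
import Data.List.Relation.Binary.Permutation.Setoid as PermutationOf
import Data.List.Relation.Binary.Permutation.Setoid.Properties as PermutationOfₚ
open import Data.Product using (_×_; _,_; proj₁; proj₂; map₂; ∃)
open import Data.Sum using (_⊎_; inj₁; inj₂)
open import Data.Unit using (tt)
open import Function using (_∘_)
open import Function.Bundles using (_⇔_; mk⇔)
open import Relation.Nullary using (¬_; yes; no)
open import Relation.Unary using (Pred; Decidable)
open import Relation.Binary using (Rel; Transitive)
open import Level using (0ℓ)
open import Relation.Binary.PropositionalEquality
  using (_≡_; refl; sym; trans; cong; cong₂; subst; module ≡-Reasoning)

<ᵇ-true : ∀ {m n} → m ℕ.< n → (m <ᵇ n) ≡ true
<ᵇ-true {m} {n} m<n with m <ᵇ n | ℕₚ.<⇒<ᵇ m<n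
... | true | _ = refl

<ᵇ-false : ∀ {m n} → m ℕ.≤ n → (n <ᵇ m) ≡ false
<ᵇ-false {m} {n} m≤n with n <ᵇ m in eq
... | false = refl
... | true = ⊥-elim (ℕₚ.≤⇒≯ m≤n (ℕₚ.<ᵇ⇒< n m (subst T (sym eq) tt)))

+[m+n]-+m≡+n : ∀ m n → + (m + n) - + m ≡ + n
+[m+n]-+m≡+n m n = begin
  + (m + n) - + m     ≡⟨ ℤₚ.[+m]-[+n]≡m⊖n (m + n) m ⟩
  (m + n) ℤ.⊖ m      ≡⟨ ℤₚ.⊖-≥ (ℕₚ.m≤m+n m n) ⟩
  + (m + n ℕ.∸ m)    ≡⟨ cong +_ (ℕₚ.m+n∸m≡n m n) ⟩
  + n                ∎
  where open ≡-Reasoning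

-- Intervals of natural numbers

length-range : ∀ a m → length (range a m) ≡ m
length-range a zero = refl
length-range a (suc m) = cong suc (length-range (suc a) m)

map-+-range : ∀ c a m → map (_+ c) (range a m) ≡ range (a + c) m
map-+-range c a zero = refl
map-+-range c a (suc m) = cong (a + c ∷_) (map-+-range c (suc a) m)

range-+ : ∀ a m l → range a (m + l) ≡ range a m ++ range (a + m) l
range-+ a zero l = cong (λ b → range b l) (sym (ℕₚ.+-identityʳ a))
range-+ a (suc m) l = cong (a ∷_) (begin
  range (suc a) (m + l)                  ≡⟨ range-+ (suc a) m l ⟩
  range (suc a) m ++ range (suc a + m) l ≡⟨ cong (λ b → range (suc a) m ++ range b l) (sym (ℕₚ.+-suc a m)) ⟩
  range (suc a) m ++ range (a + suc m) l ∎)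
  where open ≡-Reasoning

range-suc : ∀ a m → range a (suc m) ≡ range a m ∷ʳ (a + m)
range-suc a m = trans (cong (range a) (ℕₚ.+-comm 1 m)) (range-+ a m 1)

∈-range⁻ : ∀ {i} a m → i ∈ range a m → a ℕ.≤ i × i ℕ.< a + m
∈-range⁻ a (suc m) (here refl) = ℕₚ.≤-refl , ℕₚ.m<m+n a (ℕ.s≤s ℕ.z≤n)
∈-range⁻ {i} a (suc m) (there i∈) with ∈-range⁻ (suc a) m i∈
... | a<i , i<a+m = ℕₚ.<⇒≤ a<i , subst (i ℕ.<_) (sym (ℕₚ.+-suc a m)) i<a+m

range-all≥ : ∀ a m → All (a ℕ.≤_) (range a m)
range-all≥ a m = All.tabulate (proj₁ ∘ ∈-range⁻ a m)

range-all< : ∀ a m → All (ℕ._< a + m) (range a m)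
range-all< a m = All.tabulate (proj₂ ∘ ∈-range⁻ a m)

∈-range⁺ : ∀ {i} a m → a ℕ.≤ i → i ℕ.< a + m → i ∈ range a m
∈-range⁺ a zero a≤i i<a+0 = ⊥-elim (ℕₚ.<-irrefl refl (ℕₚ.<-≤-trans (subst (_ ℕ.<_) (ℕₚ.+-identityʳ a) i<a+0) a≤i))
∈-range⁺ {i} a (suc m) a≤i i<a+1+m with a ℕₚ.≟ i
... | yes refl = here refl
... | no a≢i = there (∈-range⁺ (suc a) m (ℕₚ.≤∧≢⇒< a≤i a≢i) (subst (i ℕ.<_) (ℕₚ.+-suc a m) i<a+1+m))

range-increasing : ∀ a m → Linked ℕ._<_ (range a m)
range-increasing a zero = []
range-increasing a (suc zero) = [-]
range-increasing a (suc (suc m)) = ℕₚ.n<1+n a ∷ range-increasing (suc a) (suc m)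

top∷range↭range : ∀ a m → (m + a) ∷ range a m ↭ range a (suc m)
top∷range↭range a m = begin
  (m + a) ∷ range a m    ↭⟨ ↭ₚ.∷↭∷ʳ (m + a) (range a m) ⟩
  range a m ∷ʳ (m + a)   ≡⟨ cong (range a m ∷ʳ_) (ℕₚ.+-comm m a) ⟩
  range a m ∷ʳ (a + m)   ≡⟨ range-suc a m ⟨
  range a (suc m)        ∎
  where open PermutationReasoning

-- Shuffles

shuffle-[]ʳ : ∀ xs → shuffle xs [] ≡ [ xs ]
shuffle-[]ʳ [] = refl
shuffle-[]ʳ (x ∷ xs) = refl

∈-shuffle-∷⁻ : ∀ a as b bs {σ} → σ ∈ shuffle (a ∷ as) (b ∷ bs) →
  (∃ λ τ → τ ∈ shuffle as (b ∷ bs) × σ ≡ a ∷ τ) ⊎ (∃ λ τ → τ ∈ shuffle (a ∷ as) bs × σ ≡ b ∷ τ)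
∈-shuffle-∷⁻ a as b bs σ∈ with ∈ₚ.∈-++⁻ (map (a ∷_) (shuffle as (b ∷ bs))) σ∈
... | inj₁ σ∈ˡ = inj₁ (∈ₚ.∈-map⁻ (a ∷_) σ∈ˡ)
... | inj₂ σ∈ʳ = inj₂ (∈ₚ.∈-map⁻ (b ∷_) σ∈ʳ)

shuffle-↭ : ∀ xs ys {σ} → σ ∈ shuffle xs ys → σ ↭ xs ++ ys
shuffle-↭ [] ys (here refl) = ↭-refl
shuffle-↭ (a ∷ as) [] (here refl) = ↭-reflexive (sym (Listₚ.++-identityʳ (a ∷ as)))
shuffle-↭ (a ∷ as) (b ∷ bs) σ∈ with ∈-shuffle-∷⁻ a as b bs σ∈
... | inj₁ (τ , τ∈ , refl) = prep a (shuffle-↭ as (b ∷ bs) τ∈)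
... | inj₂ (τ , τ∈ , refl) = ↭-trans (prep b (shuffle-↭ (a ∷ as) bs τ∈)) (↭-sym (↭ₚ.shift b (a ∷ as) bs))

filter-shuffle : ∀ {p} {P : Pred ℕ p} (P? : Decidable P) xs ys {σ} → All (¬_ ∘ P) xs →
  σ ∈ shuffle xs ys → filter P? σ ≡ filter P? ys
filter-shuffle P? [] ys _ (here refl) = refl
filter-shuffle P? (a ∷ as) [] ¬Pxs (here refl) = Listₚ.filter-none P? ¬Pxs
filter-shuffle P? (a ∷ as) (b ∷ bs) (¬Pa ∷ ¬Pas) σ∈ with ∈-shuffle-∷⁻ a as b bs σ∈
... | inj₁ (τ , τ∈ , refl) = trans (Listₚ.filter-reject P? ¬Pa) (filter-shuffle P? as (b ∷ bs) ¬Pas τ∈)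
... | inj₂ (τ , τ∈ , refl) = begin
  filter P? ([ b ] ++ τ)             ≡⟨ Listₚ.filter-++ P? [ b ] τ ⟩
  filter P? [ b ] ++ filter P? τ     ≡⟨ cong (filter P? [ b ] ++_) (filter-shuffle P? (a ∷ as) bs (¬Pa ∷ ¬Pas) τ∈) ⟩
  filter P? [ b ] ++ filter P? bs    ≡⟨ Listₚ.filter-++ P? [ b ] bs ⟨
  filter P? ([ b ] ++ bs)            ∎
  where open ≡-Reasoning

map-∷-∷ʳ : ∀ {A : Set} (a x : A) L → map (a ∷_) (map (_∷ʳ x) L) ≡ map (_∷ʳ x) (map (a ∷_) L)
map-∷-∷ʳ a x L = trans (sym (Listₚ.map-∘ L)) (Listₚ.map-∘ L)

++-interchange : ∀ {A : Set} (P Q R S : List A) → (P ++ Q) ++ (R ++ S) ↭ (P ++ R) ++ (Q ++ S)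
++-interchange P Q R S = begin
  (P ++ Q) ++ (R ++ S)   ≡⟨ Listₚ.++-assoc P Q (R ++ S) ⟩
  P ++ (Q ++ (R ++ S))   ↭⟨ ↭ₚ.++⁺ˡ P (↭ₚ.shifts Q R) ⟩
  P ++ (R ++ (Q ++ S))   ≡⟨ Listₚ.++-assoc P R (Q ++ S) ⟨
  (P ++ R) ++ (Q ++ S)   ∎
  where open PermutationReasoning

shuffle-∷ʳ : ∀ (xs ys : List ℕ) x y →
  shuffle (xs ∷ʳ x) (ys ∷ʳ y) ↭ map (_∷ʳ x) (shuffle xs (ys ∷ʳ y)) ++ map (_∷ʳ y) (shuffle (xs ∷ʳ x) ys)
shuffle-∷ʳ [] [] x y = ↭.↭-swap _ _ ↭-refl
shuffle-∷ʳ [] (b ∷ bs) x y = begin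
  (x ∷ b ∷ bs ∷ʳ y) ∷ map (b ∷_) (shuffle [ x ] (bs ∷ʳ y))
    ↭⟨ prep _ (↭ₚ.map⁺ (b ∷_) (shuffle-∷ʳ [] bs x y)) ⟩
  (x ∷ b ∷ bs ∷ʳ y) ∷ (b ∷ (bs ∷ʳ y) ∷ʳ x) ∷ map (b ∷_) (map (_∷ʳ y) (shuffle [ x ] bs))
    ↭⟨ ↭.↭-swap _ _ ↭-refl ⟩
  (b ∷ (bs ∷ʳ y) ∷ʳ x) ∷ (x ∷ b ∷ bs ∷ʳ y) ∷ map (b ∷_) (map (_∷ʳ y) (shuffle [ x ] bs))
    ≡⟨ cong (λ l → (b ∷ (bs ∷ʳ y) ∷ʳ x) ∷ (x ∷ b ∷ bs ∷ʳ y) ∷ l) (map-∷-∷ʳ b y (shuffle [ x ] bs)) ⟩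
  (b ∷ (bs ∷ʳ y) ∷ʳ x) ∷ (x ∷ b ∷ bs ∷ʳ y) ∷ map (_∷ʳ y) (map (b ∷_) (shuffle [ x ] bs))
    ∎
  where open PermutationReasoning
shuffle-∷ʳ (a ∷ as) [] x y = begin
  map (a ∷_) (shuffle (as ∷ʳ x) [ y ]) ++ [ y ∷ a ∷ as ∷ʳ x ]
    ↭⟨ ↭ₚ.++⁺ʳ _ (↭ₚ.map⁺ (a ∷_) (shuffle-∷ʳ as [] x y)) ⟩
  map (a ∷_) (map (_∷ʳ x) S ++ map (_∷ʳ y) (shuffle (as ∷ʳ x) [])) ++ [ y ∷ a ∷ as ∷ʳ x ]
    ≡⟨ cong (λ l → map (a ∷_) (map (_∷ʳ x) S ++ map (_∷ʳ y) l) ++ [ y ∷ a ∷ as ∷ʳ x ]) (shuffle-[]ʳ (as ∷ʳ x)) ⟩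
  map (a ∷_) (map (_∷ʳ x) S ++ [ (as ∷ʳ x) ∷ʳ y ]) ++ [ y ∷ a ∷ as ∷ʳ x ]
    ≡⟨ cong (_++ [ y ∷ a ∷ as ∷ʳ x ]) (Listₚ.map-++ (a ∷_) (map (_∷ʳ x) S) _) ⟩
  (map (a ∷_) (map (_∷ʳ x) S) ++ [ a ∷ (as ∷ʳ x) ∷ʳ y ]) ++ [ y ∷ a ∷ as ∷ʳ x ]
    ≡⟨ Listₚ.++-assoc (map (a ∷_) (map (_∷ʳ x) S)) _ _ ⟩
  map (a ∷_) (map (_∷ʳ x) S) ++ ((a ∷ (as ∷ʳ x) ∷ʳ y) ∷ [ y ∷ a ∷ as ∷ʳ x ])
    ↭⟨ ↭ₚ.++⁺ˡ (map (a ∷_) (map (_∷ʳ x) S)) (↭.↭-swap _ _ ↭-refl) ⟩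
  map (a ∷_) (map (_∷ʳ x) S) ++ ((y ∷ a ∷ as ∷ʳ x) ∷ [ a ∷ (as ∷ʳ x) ∷ʳ y ])
    ≡⟨ cong (_++ ((y ∷ a ∷ as ∷ʳ x) ∷ [ a ∷ (as ∷ʳ x) ∷ʳ y ])) (map-∷-∷ʳ a x S) ⟩
  map (_∷ʳ x) (map (a ∷_) S) ++ ((y ∷ a ∷ as ∷ʳ x) ∷ [ a ∷ (as ∷ʳ x) ∷ʳ y ])
    ≡⟨ Listₚ.++-assoc (map (_∷ʳ x) (map (a ∷_) S)) _ _ ⟨
  (map (_∷ʳ x) (map (a ∷_) S) ++ [ y ∷ a ∷ as ∷ʳ x ]) ++ [ a ∷ (as ∷ʳ x) ∷ʳ y ]
    ≡⟨ cong (_++ [ a ∷ (as ∷ʳ x) ∷ʳ y ]) (Listₚ.map-++ (_∷ʳ x) (map (a ∷_) S) _) ⟨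
  map (_∷ʳ x) (map (a ∷_) S ++ [ y ∷ a ∷ as ]) ++ [ a ∷ (as ∷ʳ x) ∷ʳ y ]
    ∎
  where
  open PermutationReasoning
  S = shuffle as [ y ]
shuffle-∷ʳ (a ∷ as) (b ∷ bs) x y = begin
  map (a ∷_) (shuffle (as ∷ʳ x) (b ∷ bs ∷ʳ y)) ++ map (b ∷_) (shuffle (a ∷ as ∷ʳ x) (bs ∷ʳ y))
    ↭⟨ ↭ₚ.++⁺ (↭ₚ.map⁺ (a ∷_) (shuffle-∷ʳ as (b ∷ bs) x y)) (↭ₚ.map⁺ (b ∷_) (shuffle-∷ʳ (a ∷ as) bs x y)) ⟩
  map (a ∷_) (map (_∷ʳ x) A₁ ++ map (_∷ʳ y) A₂) ++ map (b ∷_) (map (_∷ʳ x) B₁ ++ map (_∷ʳ y) B₂)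
    ≡⟨ cong₂ _++_ (Listₚ.map-++ (a ∷_) (map (_∷ʳ x) A₁) _) (Listₚ.map-++ (b ∷_) (map (_∷ʳ x) B₁) _) ⟩
  (map (a ∷_) (map (_∷ʳ x) A₁) ++ map (a ∷_) (map (_∷ʳ y) A₂)) ++ (map (b ∷_) (map (_∷ʳ x) B₁) ++ map (b ∷_) (map (_∷ʳ y) B₂))
    ↭⟨ ++-interchange (map (a ∷_) (map (_∷ʳ x) A₁)) _ _ _ ⟩
  (map (a ∷_) (map (_∷ʳ x) A₁) ++ map (b ∷_) (map (_∷ʳ x) B₁)) ++ (map (a ∷_) (map (_∷ʳ y) A₂) ++ map (b ∷_) (map (_∷ʳ y) B₂))
    ≡⟨ cong₂ _++_ (cong₂ _++_ (map-∷-∷ʳ a x A₁) (map-∷-∷ʳ b x B₁)) (cong₂ _++_ (map-∷-∷ʳ a y A₂) (map-∷-∷ʳ b y B₂)) ⟩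
  (map (_∷ʳ x) (map (a ∷_) A₁) ++ map (_∷ʳ x) (map (b ∷_) B₁)) ++ (map (_∷ʳ y) (map (a ∷_) A₂) ++ map (_∷ʳ y) (map (b ∷_) B₂))
    ≡⟨ cong₂ _++_ (Listₚ.map-++ (_∷ʳ x) (map (a ∷_) A₁) _) (Listₚ.map-++ (_∷ʳ y) (map (a ∷_) A₂) _) ⟨
  map (_∷ʳ x) (map (a ∷_) A₁ ++ map (b ∷_) B₁) ++ map (_∷ʳ y) (map (a ∷_) A₂ ++ map (b ∷_) B₂)
    ∎
  where
  open PermutationReasoning
  A₁ = shuffle as (b ∷ bs ∷ʳ y)
  A₂ = shuffle (as ∷ʳ x) (b ∷ bs)
  B₁ = shuffle (a ∷ as) (bs ∷ʳ y)
  B₂ = shuffle (a ∷ as ∷ʳ x) bs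

-- The major index under insertion of a smallest letter

descents : List ℕ → ℕ
descents [] = 0
descents (a ∷ []) = 0
descents (a ∷ b ∷ t) = (if b <ᵇ a then 1 else 0) + descents (b ∷ t)

majFrom-suc : ∀ j w → majFrom (suc j) w ≡ majFrom j w + descents w
majFrom-suc j [] = refl
majFrom-suc j (a ∷ []) = refl
majFrom-suc j (a ∷ b ∷ t) with b <ᵇ a | majFrom-suc (suc j) (b ∷ t)
... | true | ih = trans (cong (λ s → suc j + s) ih) (rearrange j _ _)
  where
  rearrange : ∀ j m d → suc j + (m + d) ≡ (j + m) + (1 + d)
  rearrange = solve-∀
... | false | ih = ih

descents-∷-min : ∀ x q → All (x ℕ.<_) q → descents (x ∷ q) ≡ descents q
descents-∷-min x [] _ = refl
descents-∷-min x (c ∷ q) (x<c ∷ _) rewrite <ᵇ-false (ℕₚ.<⇒≤ x<c) = refl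

majFrom-∷-min : ∀ j x q → All (x ℕ.<_) q → majFrom j (x ∷ q) ≡ majFrom j q + descents q
majFrom-∷-min j x [] _ = refl
majFrom-∷-min j x (c ∷ q) (x<c ∷ _) rewrite <ᵇ-false (ℕₚ.<⇒≤ x<c) = majFrom-suc j (c ∷ q)

majFrom-constant : ∀ j c w → All (_≡ c) w → majFrom j w ≡ 0
majFrom-constant j c [] _ = refl
majFrom-constant j c (a ∷ []) _ = refl
majFrom-constant j c (a ∷ b ∷ t) (refl ∷ refl ∷ t≡c) = cong₂ _+_
  (cong (λ e → if e then j else 0) (<ᵇ-false (ℕₚ.≤-refl {c})))
  (majFrom-constant (suc j) c (c ∷ t) (refl ∷ t≡c))

majFrom-map-+ : ∀ k j w → majFrom j (map (_+ k) w) ≡ majFrom j w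
majFrom-map-+ k j [] = refl
majFrom-map-+ k j (a ∷ []) = refl
majFrom-map-+ k j (a ∷ b ∷ t) = cong₂ _+_
  (cong (λ e → if e then j else 0) (+-<ᵇ-+ k b a))
  (majFrom-map-+ k (suc j) (b ∷ t))
  where
  +-<ᵇ-+ : ∀ k b a → (b + k <ᵇ a + k) ≡ (b <ᵇ a)
  +-<ᵇ-+ k b a = trans (cong₂ _<ᵇ_ (ℕₚ.+-comm b k) (ℕₚ.+-comm a k)) (k+-<ᵇ-k+ k)
    where
    k+-<ᵇ-k+ : ∀ k → (k + b <ᵇ k + a) ≡ (b <ᵇ a)
    k+-<ᵇ-k+ zero = refl
    k+-<ᵇ-k+ (suc k) = k+-<ᵇ-k+ k

-- Increase of maj when a new smallest letter is put between the letter b, at position n, and q.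
gainAfter : ℕ → ℕ → List ℕ → ℕ
gainAfter b n [] = n
gainAfter b n (c ∷ q) = if c <ᵇ b then 0 else n

-- gainAfter for the last letter of p, where j is the position of the first letter of p.
junctionGain : ℕ → List ℕ → List ℕ → ℕ
junctionGain j [] q = 0
junctionGain j (b ∷ []) q = gainAfter b j q
junctionGain j (b ∷ c ∷ p) q = junctionGain (suc j) (c ∷ p) q

majFrom-insert-min : ∀ j p x q → All (x ℕ.<_) (p ++ q) →
  majFrom j (p ++ x ∷ q) ≡ majFrom j (p ++ q) + (junctionGain j p q + descents q)
majFrom-insert-min j [] x q x<q = majFrom-∷-min j x q x<q
majFrom-insert-min j (b ∷ []) x [] (x<b ∷ _) rewrite <ᵇ-true x<b = refl
majFrom-insert-min j (b ∷ []) x (c ∷ q) (x<b ∷ x<q)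
  rewrite <ᵇ-true x<b | majFrom-∷-min (suc j) x (c ∷ q) x<q = split (c <ᵇ b)
  where
  M = majFrom (suc j) (c ∷ q)
  d = descents (c ∷ q)
  split : ∀ e → j + (M + d) ≡ ((if e then j else 0) + M) + ((if e then 0 else j) + d)
  split true = sym (ℕₚ.+-assoc j M d)
  split false = rearrange j M d
    where
    rearrange : ∀ j m d → j + (m + d) ≡ m + (j + d)
    rearrange = solve-∀
majFrom-insert-min j (b ∷ c ∷ p) x q (_ ∷ x<cpq)
  rewrite majFrom-insert-min (suc j) (c ∷ p) x q x<cpq =
  sym (ℕₚ.+-assoc (if c <ᵇ b then j else 0) (majFrom (suc j) (c ∷ p ++ q)) _)

junctionGain-∷ʳ : ∀ j p b q → junctionGain j (p ∷ʳ b) q ≡ gainAfter b (length p + j) q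
junctionGain-∷ʳ j [] b q = refl
junctionGain-∷ʳ j (a ∷ []) b q = refl
junctionGain-∷ʳ j (a ∷ c ∷ p) b q = trans (junctionGain-∷ʳ (suc j) (c ∷ p) b q)
  (cong (λ n → gainAfter b n q) (ℕₚ.+-suc (length (c ∷ p)) j))

-- Increase of maj when a new smallest letter is put between reverse rp and q; the prefix is
-- kept reversed so that its last letter is at hand.
majIncrement : List ℕ → List ℕ → ℕ
majIncrement [] q = descents q
majIncrement (b ∷ rp) q = gainAfter b (suc (length rp)) q + descents q

maj-insert-min : ∀ rp x q → All (x ℕ.<_) (reverse rp ++ q) →
  maj (reverse rp ++ x ∷ q) ≡ maj (reverse rp ++ q) + majIncrement rp q
maj-insert-min [] x q x<q = majFrom-∷-min 1 x q x<q
maj-insert-min (b ∷ rp) x q x<rpq = begin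
  maj (reverse (b ∷ rp) ++ x ∷ q)
    ≡⟨ majFrom-insert-min 1 (reverse (b ∷ rp)) x q x<rpq ⟩
  maj (reverse (b ∷ rp) ++ q) + (junctionGain 1 (reverse (b ∷ rp)) q + descents q)
    ≡⟨ cong (λ g → maj (reverse (b ∷ rp) ++ q) + (g + descents q)) gain ⟩
  maj (reverse (b ∷ rp) ++ q) + majIncrement (b ∷ rp) q ∎
  where
  open ≡-Reasoning
  gain : junctionGain 1 (reverse (b ∷ rp)) q ≡ gainAfter b (suc (length rp)) q
  gain = begin
    junctionGain 1 (reverse (b ∷ rp)) q     ≡⟨ cong (λ p → junctionGain 1 p q) (Listₚ.unfold-reverse b rp) ⟩
    junctionGain 1 (reverse rp ∷ʳ b) q      ≡⟨ junctionGain-∷ʳ 1 (reverse rp) b q ⟩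
    gainAfter b (length (reverse rp) + 1) q ≡⟨ cong (λ n → gainAfter b n q) (trans (ℕₚ.+-comm _ 1) (cong suc (Listₚ.length-reverse rp))) ⟩
    gainAfter b (suc (length rp)) q ∎

-- The increases for the length rp + 1 slots of reverse rp in reverse rp ++ q, from right to left.
majIncrements : List ℕ → List ℕ → List ℕ
majIncrements [] q = [ majIncrement [] q ]
majIncrements (b ∷ rp) q = majIncrement (b ∷ rp) q ∷ majIncrements rp (b ∷ q)

descents-++-∷ : ∀ w a t → descents (w ++ a ∷ t) ≡ descents (w ++ [ a ]) + descents (a ∷ t)
descents-++-∷ [] a t = refl
descents-++-∷ (c ∷ []) a t = cong (_+ descents (a ∷ t)) (sym (ℕₚ.+-identityʳ (if a <ᵇ c then 1 else 0)))
descents-++-∷ (c ∷ d ∷ w) a t rewrite descents-++-∷ (d ∷ w) a t =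
  sym (ℕₚ.+-assoc (if d <ᵇ c then 1 else 0) (descents (d ∷ w ++ [ a ])) (descents (a ∷ t)))

gainAfter-++-∷ : ∀ b n w a t → gainAfter b n (w ++ a ∷ t) ≡ gainAfter b n (w ++ [ a ])
gainAfter-++-∷ b n [] a t = refl
gainAfter-++-∷ b n (c ∷ w) a t = refl

majIncrement-++-∷ : ∀ rp w a t →
  majIncrement rp (w ++ a ∷ t) ≡ majIncrement rp (w ++ [ a ]) + descents (a ∷ t)
majIncrement-++-∷ [] w a t = descents-++-∷ w a t
majIncrement-++-∷ (b ∷ rp) w a t
  rewrite gainAfter-++-∷ b (suc (length rp)) w a t | descents-++-∷ w a t =
  sym (ℕₚ.+-assoc (gainAfter b (suc (length rp)) (w ++ [ a ])) _ _)

majIncrements-++-∷ : ∀ rp w a t →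
  majIncrements rp (w ++ a ∷ t) ≡ map (_+ descents (a ∷ t)) (majIncrements rp (w ++ [ a ]))
majIncrements-++-∷ [] w a t = cong [_] (majIncrement-++-∷ [] w a t)
majIncrements-++-∷ (b ∷ rp) w a t =
  cong₂ _∷_ (majIncrement-++-∷ (b ∷ rp) w a t) (majIncrements-++-∷ rp (b ∷ w) a t)

module _ {n A} (A↭ : A ↭ range 0 (suc n)) (d : ℕ) where

  bottom∷shifted↭range : d ∷ map (_+ suc d) A ↭ range d (suc (suc n))
  bottom∷shifted↭range = prep d (↭-trans (↭ₚ.map⁺ (_+ suc d) A↭) (↭-reflexive (map-+-range (suc d) 0 (suc n))))

  top∷shifted↭range : (suc n + d) ∷ map (_+ d) A ↭ range d (suc (suc n))
  top∷shifted↭range = ↭-trans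
    (prep _ (↭-trans (↭ₚ.map⁺ (_+ d) A↭) (↭-reflexive (map-+-range d 0 (suc n)))))
    (top∷range↭range d (suc n))

majIncrements-[_] : ∀ b rp → majIncrements rp [ b ] ↭ range 0 (suc (length rp))
majIncrements-[ b ] [] = ↭-refl
majIncrements-[ b ] (a ∷ rp) rewrite majIncrements-++-∷ rp [] a [ b ] with b <ᵇ a
... | true = bottom∷shifted↭range (majIncrements-[ a ] rp) 0
... | false = top∷shifted↭range (majIncrements-[ a ] rp) 0

majIncrements-[] : ∀ rp → majIncrements rp [] ↭ range 0 (suc (length rp))
majIncrements-[] [] = ↭-refl
majIncrements-[] (b ∷ rp) = ↭-trans (prep _ (majIncrements-[ b ] rp)) (top∷range↭range 0 (suc (length rp)))

majIncrements-∷-min : ∀ rp x q → All (x ℕ.<_) (rp ++ q) → majIncrements rp (x ∷ q) ↭ majIncrements rp q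
majIncrements-∷-min [] x q x<q rewrite descents-∷-min x q x<q = ↭-refl
majIncrements-∷-min (b ∷ rp) x q (x<b ∷ x<rpq)
  rewrite majIncrements-++-∷ rp [] b (x ∷ q) | majIncrements-++-∷ rp [] b q
        | <ᵇ-true x<b | descents-∷-min x q (Allₚ.++⁻ʳ rp x<rpq) = cases q
  where
  A↭ = majIncrements-[ b ] rp
  rotate : ∀ d → d ∷ map (_+ suc d) (majIncrements rp [ b ]) ↭ (suc (length rp) + d) ∷ map (_+ d) (majIncrements rp [ b ])
  rotate d = ↭-trans (bottom∷shifted↭range A↭ d) (↭-sym (top∷shifted↭range A↭ d))
  cases : ∀ q → descents q ∷ map (_+ suc (descents q)) (majIncrements rp [ b ]) ↭
                (gainAfter b (suc (length rp)) q + descents q) ∷ map (_+ descents (b ∷ q)) (majIncrements rp [ b ])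
  cases [] = rotate 0
  cases (c ∷ q) with c <ᵇ b
  ... | true = ↭-refl
  ... | false = rotate (descents (c ∷ q))

-- Multisets

module _ {A : Set} where
  open PermutationOf (↭.↭-setoid {A = A}) public using () renaming (_↭_ to _≈ₘ_)

-- The multisets of size m drawn from L, each listed in the order of L.
multisets : ∀ {A : Set} → ℕ → List A → List (List A)
multisets zero L = [ [] ]
multisets (suc m) [] = []
multisets (suc m) (x ∷ L) = map (x ∷_) (multisets m (x ∷ L)) ++ multisets (suc m) L

module _ {A : Set} where
  private
    module ≈ₘ = PermutationOf (↭.↭-setoid {A = A})
    module ≈ₘₚ = PermutationOfₚ (↭.↭-setoid {A = A})

  map-∷-≈ₘ : ∀ (x : A) {S T} → S ≈ₘ T → map (x ∷_) S ≈ₘ map (x ∷_) T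
  map-∷-≈ₘ x = ≈ₘₚ.map⁺ (↭.↭-setoid {A = A}) (prep x)

  map-≈ₘ-local : ∀ {B : Set} (f g : B → List A) U → (∀ {l} → l ∈ U → f l ↭ g l) → map f U ≈ₘ map g U
  map-≈ₘ-local f g [] _ = ≈ₘ.↭-refl
  map-≈ₘ-local f g (l ∷ U) f↭g = ≈ₘ.prep (f↭g (here refl)) (map-≈ₘ-local f g U (λ l∈ → f↭g (there l∈)))

  multisets-swap : ∀ m (x y : A) L → multisets m (x ∷ y ∷ L) ≈ₘ multisets m (y ∷ x ∷ L)
  multisets-swap zero x y L = ≈ₘ.↭-refl
  multisets-swap (suc zero) x y L = ≈ₘ.↭-swap [ x ] [ y ] ≈ₘ.↭-refl
  multisets-swap (suc (suc m)) x y L = begin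
    map (x ∷_) (multisets (suc m) (x ∷ y ∷ L)) ++ (map (y ∷_) Y ++ R)
      ↭⟨ ≈ₘₚ.++⁺ʳ _ (map-∷-≈ₘ x (multisets-swap (suc m) x y L)) ⟩
    map (x ∷_) (map (y ∷_) (multisets m (y ∷ x ∷ L)) ++ X) ++ (map (y ∷_) Y ++ R)
      ≡⟨ cong (_++ (map (y ∷_) Y ++ R)) (Listₚ.map-++ (x ∷_) (map (y ∷_) (multisets m (y ∷ x ∷ L))) X) ⟩
    (map (x ∷_) (map (y ∷_) (multisets m (y ∷ x ∷ L))) ++ map (x ∷_) X) ++ (map (y ∷_) Y ++ R)
      ↭⟨ ≈ₘₚ.++⁺ʳ _ (≈ₘₚ.++⁺ʳ _ xy↭yx) ⟩
    (map (y ∷_) (map (x ∷_) (multisets m (x ∷ y ∷ L))) ++ map (x ∷_) X) ++ (map (y ∷_) Y ++ R)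
      ≡⟨ Listₚ.++-assoc (map (y ∷_) (map (x ∷_) (multisets m (x ∷ y ∷ L)))) _ _ ⟩
    map (y ∷_) (map (x ∷_) (multisets m (x ∷ y ∷ L))) ++ (map (x ∷_) X ++ (map (y ∷_) Y ++ R))
      ↭⟨ ≈ₘₚ.++⁺ˡ (map (y ∷_) (map (x ∷_) (multisets m (x ∷ y ∷ L)))) (≈ₘₚ.shifts (map (x ∷_) X) (map (y ∷_) Y)) ⟩
    map (y ∷_) (map (x ∷_) (multisets m (x ∷ y ∷ L))) ++ (map (y ∷_) Y ++ (map (x ∷_) X ++ R))
      ≡⟨ Listₚ.++-assoc (map (y ∷_) (map (x ∷_) (multisets m (x ∷ y ∷ L)))) _ _ ⟨
    (map (y ∷_) (map (x ∷_) (multisets m (x ∷ y ∷ L))) ++ map (y ∷_) Y) ++ (map (x ∷_) X ++ R)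
      ≡⟨ cong (_++ (map (x ∷_) X ++ R)) (Listₚ.map-++ (y ∷_) (map (x ∷_) (multisets m (x ∷ y ∷ L))) Y) ⟨
    map (y ∷_) (map (x ∷_) (multisets m (x ∷ y ∷ L)) ++ Y) ++ (map (x ∷_) X ++ R)
      ↭⟨ ≈ₘₚ.++⁺ʳ _ (map-∷-≈ₘ y (multisets-swap (suc m) x y L)) ⟩
    map (y ∷_) (multisets (suc m) (y ∷ x ∷ L)) ++ (map (x ∷_) X ++ R)
      ∎
    where
    open ≈ₘ.PermutationReasoning
    X = multisets (suc m) (x ∷ L)
    Y = multisets (suc m) (y ∷ L)
    R = multisets (suc (suc m)) L
    xy↭yx : map (x ∷_) (map (y ∷_) (multisets m (y ∷ x ∷ L))) ≈ₘ map (y ∷_) (map (x ∷_) (multisets m (x ∷ y ∷ L)))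
    xy↭yx = begin
      map (x ∷_) (map (y ∷_) (multisets m (y ∷ x ∷ L)))
        ↭⟨ map-∷-≈ₘ x (map-∷-≈ₘ y (multisets-swap m y x L)) ⟩
      map (x ∷_) (map (y ∷_) (multisets m (x ∷ y ∷ L)))
        ≡⟨ Listₚ.map-∘ (multisets m (x ∷ y ∷ L)) ⟨
      map (λ l → x ∷ y ∷ l) (multisets m (x ∷ y ∷ L))
        ↭⟨ map-≈ₘ-local _ _ (multisets m (x ∷ y ∷ L)) (λ _ → ↭.↭-swap x y ↭.↭-refl) ⟩
      map (λ l → y ∷ x ∷ l) (multisets m (x ∷ y ∷ L))
        ≡⟨ Listₚ.map-∘ (multisets m (x ∷ y ∷ L)) ⟩
      map (y ∷_) (map (x ∷_) (multisets m (x ∷ y ∷ L)))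
        ∎

  ∈-resp-≈ₘ : ∀ {S T : List (List A)} {x} → S ≈ₘ T → x ∈ S → ∃ λ y → y ∈ T × x ↭ y
  ∈-resp-≈ₘ S≈T x∈S = find (≈ₘₚ.∈-resp-↭ S≈T (Any.map ↭.↭-reflexive x∈S))

  multisets-↭ : ∀ m {L L′ : List A} → L ↭ L′ → multisets m L ≈ₘ multisets m L′
  multisets-↭ zero _ = ≈ₘ.↭-refl
  multisets-↭ (suc m) ↭.refl = ≈ₘ.↭-refl
  multisets-↭ (suc m) (prep x p) = ≈ₘₚ.++⁺ (map-∷-≈ₘ x (multisets-↭ m (prep x p))) (multisets-↭ (suc m) p)
  multisets-↭ (suc m) (↭.trans p q) = ≈ₘ.↭-trans (multisets-↭ (suc m) p) (multisets-↭ (suc m) q)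
  multisets-↭ (suc m) {x ∷ y ∷ L} (swap x y p) = ≈ₘ.↭-trans (multisets-swap (suc m) x y L)
    (≈ₘₚ.++⁺ (map-∷-≈ₘ y (multisets-↭ m (prep y (prep x p))))
      (≈ₘₚ.++⁺ (map-∷-≈ₘ x (multisets-↭ m (prep x p))) (multisets-↭ (suc m) p)))

multisets-map : ∀ {A B : Set} (f : A → B) m L → multisets m (map f L) ≡ map (map f) (multisets m L)
multisets-map f zero L = refl
multisets-map f (suc m) [] = refl
multisets-map f (suc m) (x ∷ L) = begin
  map (f x ∷_) (multisets m (f x ∷ map f L)) ++ multisets (suc m) (map f L)
    ≡⟨ cong₂ _++_ (cong (map (f x ∷_)) (multisets-map f m (x ∷ L))) (multisets-map f (suc m) L) ⟩
  map (f x ∷_) (map (map f) (multisets m (x ∷ L))) ++ map (map f) (multisets (suc m) L)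
    ≡⟨ cong (_++ map (map f) (multisets (suc m) L)) (trans (sym (Listₚ.map-∘ (multisets m (x ∷ L)))) (Listₚ.map-∘ (multisets m (x ∷ L)))) ⟩
  map (map f) (map (x ∷_) (multisets m (x ∷ L))) ++ map (map f) (multisets (suc m) L)
    ≡⟨ Listₚ.map-++ (map f) (map (x ∷_) (multisets m (x ∷ L))) _ ⟨
  map (map f) (multisets (suc m) (x ∷ L)) ∎
  where open ≡-Reasoning

ndSeqs-multisets : ∀ k a c → ndSeqs k a (a + c) ≡ multisets k (range a (suc c))
concatMap-ndSeqs-multisets : ∀ k c a →
  concatMap (λ j → map (j ∷_) (ndSeqs k j (a + c))) (range a (suc c)) ≡ multisets (suc k) (range a (suc c))
ndSeqs-multisets zero a c = refl
ndSeqs-multisets (suc k) a c = trans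
  (cong (λ l → concatMap (λ j → map (j ∷_) (ndSeqs k j (a + c))) (range a (suc l))) (ℕₚ.m+n∸m≡n a c))
  (concatMap-ndSeqs-multisets k c a)
concatMap-ndSeqs-multisets k zero a = cong (λ l → map (a ∷_) l ++ []) (ndSeqs-multisets k a 0)
concatMap-ndSeqs-multisets k (suc c) a = cong₂ _++_ (cong (map (a ∷_)) (ndSeqs-multisets k a (suc c))) (trans
  (cong (λ n → concatMap (λ j → map (j ∷_) (ndSeqs k j n)) (range (suc a) (suc c))) (ℕₚ.+-suc a c))
  (concatMap-ndSeqs-multisets k c (suc a)))

hPoly-multisets : ∀ k n → hPoly k n ≡ multisets k (map (+_) (range 0 (suc n)))
hPoly-multisets k n = trans (cong (map (map (+_))) (ndSeqs-multisets k 0 n)) (sym (multisets-map (+_) k (range 0 (suc n))))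

∈-multisets⁻ : ∀ {A : Set} k (L : List A) {s} → s ∈ multisets k L → length s ≡ k × All (_∈ L) s
∈-multisets⁻ zero L (here refl) = refl , []
∈-multisets⁻ (suc k) (x ∷ L) s∈ with ∈ₚ.∈-++⁻ (map (x ∷_) (multisets k (x ∷ L))) s∈
... | inj₂ s∈ʳ = map₂ (All.map there) (∈-multisets⁻ (suc k) L s∈ʳ)
... | inj₁ s∈ˡ with ∈ₚ.∈-map⁻ (x ∷_) s∈ˡ
...   | s′ , s′∈ , refl with ∈-multisets⁻ k (x ∷ L) s′∈
...     | |s′|≡k , s′⊆ = cong suc |s′|≡k , here refl ∷ s′⊆

Linked-∷⇒All : ∀ {A : Set} {R : Rel A 0ℓ} → Transitive R → ∀ {x xs} → Linked R (x ∷ xs) → All (R x) xs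
Linked-∷⇒All _ [-] = []
Linked-∷⇒All R-trans (Rxy ∷ Ryxs) = Linkedₚ.Linked⇒All R-trans Rxy Ryxs

∈-multisets⁺ : ∀ (L s : List ℤ) → Linked ℤ._<_ L → NonDecreasing s → All (_∈ L) s → s ∈ multisets (length s) L
∈-multisets⁺ L [] _ _ _ = here refl
∈-multisets⁺ (x ∷ L) (x ∷ s) L↑ s↑ (here refl ∷ s⊆) =
  ∈ₚ.∈-++⁺ˡ (∈ₚ.∈-map⁺ (x ∷_) (∈-multisets⁺ (x ∷ L) s L↑ (Linked.tail s↑) s⊆))
∈-multisets⁺ (x ∷ L) (y ∷ s) L↑ s↑ (there y∈L ∷ s⊆) =
  ∈ₚ.∈-++⁺ʳ (map (x ∷_) (multisets (length s) (x ∷ L)))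
    (∈-multisets⁺ L (y ∷ s) (Linked.tail L↑) s↑ (y∈L ∷ All.zipWith drop-x (y≤s , s⊆)))
  where
  x<y : x ℤ.< y
  x<y = All.lookup (Linked-∷⇒All ℤₚ.<-trans L↑) y∈L
  y≤s : All (y ℤ.≤_) s
  y≤s = Linked-∷⇒All ℤₚ.≤-trans s↑
  drop-x : ∀ {z} → y ℤ.≤ z × z ∈ x ∷ L → z ∈ L
  drop-x (y≤x , here refl) = ⊥-elim (ℤₚ.<-irrefl refl (ℤₚ.<-≤-trans x<y y≤x))
  drop-x (_ , there z∈L) = z∈L

∈-ints⁻ : ∀ {n i} → i ∈ map (+_) (range 0 (suc n)) → + 0 ≤ i × i ≤ + n
∈-ints⁻ {n} i∈ with ∈ₚ.∈-map⁻ (+_) i∈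
... | j , j∈ , refl = +≤+ ℕ.z≤n , +≤+ (ℕₚ.≤-pred (proj₂ (∈-range⁻ 0 (suc n) j∈)))

∈-ints⁺ : ∀ {n i} → + 0 ≤ i → i ≤ + n → i ∈ map (+_) (range 0 (suc n))
∈-ints⁺ {n} (+≤+ {n = j} _) (+≤+ j≤n) = ∈ₚ.∈-map⁺ (+_) (∈-range⁺ 0 (suc n) ℕ.z≤n (ℕ.s≤s j≤n))

ints-increasing : ∀ n → Linked ℤ._<_ (map (+_) (range 0 (suc n)))
ints-increasing n = Linkedₚ.map⁺ (Linked.map ℤ.+<+ (range-increasing 0 (suc n)))

-- Majcodes of shuffles with the identity word

subwordGe-map-+ : ∀ i k w → subwordGe (i + k) (map (_+ k) w) ≡ map (_+ k) (subwordGe i w)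
subwordGe-map-+ i k [] = refl
subwordGe-map-+ i k (b ∷ w) with i ℕ.≤? b
... | yes i≤b = begin
  subwordGe (i + k) (b + k ∷ map (_+ k) w)  ≡⟨ Listₚ.filter-accept ((i + k) ≤?_) (ℕₚ.+-monoˡ-≤ k i≤b) ⟩
  b + k ∷ subwordGe (i + k) (map (_+ k) w)  ≡⟨ cong (b + k ∷_) (subwordGe-map-+ i k w) ⟩
  map (_+ k) (b ∷ subwordGe i w)            ≡⟨ cong (map (_+ k)) (Listₚ.filter-accept (i ≤?_) i≤b) ⟨
  map (_+ k) (subwordGe i (b ∷ w))          ∎
  where open ≡-Reasoning
... | no i≰b = begin
  subwordGe (i + k) (b + k ∷ map (_+ k) w)  ≡⟨ Listₚ.filter-reject ((i + k) ≤?_) (i≰b ∘ ℕₚ.+-cancelʳ-≤ k i b) ⟩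
  subwordGe (i + k) (map (_+ k) w)          ≡⟨ subwordGe-map-+ i k w ⟩
  map (_+ k) (subwordGe i w)                ≡⟨ cong (map (_+ k)) (Listₚ.filter-reject (i ≤?_) i≰b) ⟨
  map (_+ k) (subwordGe i (b ∷ w))          ∎
  where open ≡-Reasoning

subwordGe-shuffle-idWord : ∀ m w {i τ} → m ℕ.< i → τ ∈ shuffle (idWord m) w → subwordGe i τ ≡ subwordGe i w
subwordGe-shuffle-idWord m w {i} m<i = filter-shuffle (i ≤?_) (idWord m) w
  (All.map (λ l<1+m i≤l → ℕₚ.<-irrefl refl (ℕₚ.<-≤-trans l<1+m (ℕₚ.≤-trans m<i i≤l))) (range-all< 1 m))

mcPrefix : ℕ → List ℕ → List ℤ
mcPrefix m σ = map (mcComp σ) (idWord m)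

mcComp-top : ∀ m σ → All (ℕ._≤ m) σ → mcComp σ m ≡ + 0
mcComp-top m σ σ≤m = cong₂ (λ u v → + u - + v) only-m nothing-above
  where
  only-m : maj (subwordGe m σ) ≡ 0
  only-m = majFrom-constant 1 m (subwordGe m σ) (All.zipWith (λ (m≤l , l≤m) → ℕₚ.≤-antisym l≤m m≤l)
    (Allₚ.all-filter (m ≤?_) σ , Allₚ.filter⁺ (m ≤?_) σ≤m))
  nothing-above : maj (subwordGe (suc m) σ) ≡ 0
  nothing-above = cong maj (Listₚ.filter-none (suc m ≤?_) (All.map ℕₚ.≤⇒≯ σ≤m))

IsPerm-length : ∀ {m σ} → IsPerm m σ → length σ ≡ m
IsPerm-length {m} σ↭ = trans (↭ₚ.↭-length σ↭) (length-range 1 m)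

IsPerm-letters≤ : ∀ {m σ} → IsPerm m σ → All (ℕ._≤ m) σ
IsPerm-letters≤ {m} σ↭ = ↭ₚ.All-resp-↭ (↭.↭-sym σ↭) (All.map ℕₚ.≤-pred (range-all< 1 m))

Mc-IsPerm : ∀ {m σ} → IsPerm m σ → Mc σ ≡ mcPrefix m σ
Mc-IsPerm {m} {σ} σ↭ = trans (Listₚ.map-cong last-is-zero (idWord (length σ)))
  (cong (λ l → mcPrefix l σ) (IsPerm-length σ↭))
  where
  last-is-zero : ∀ i → (if i ≡ᵇ length σ then + 0 else mcComp σ i) ≡ mcComp σ i
  last-is-zero i with i ≡ᵇ length σ in i≡ᵇ|σ|
  ... | false = refl
  ... | true = sym (trans (cong (mcComp σ) i≡m) (mcComp-top m σ (IsPerm-letters≤ σ↭)))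
    where
    i≡m : i ≡ m
    i≡m = trans (ℕₚ.≡ᵇ⇒≡ i (length σ) (subst T (sym i≡ᵇ|σ|) tt)) (IsPerm-length σ↭)

IsPerm-shuffleId : ∀ {n k β σ} → IsPerm n β → σ ∈ shuffleId k β → IsPerm (k + n) σ
IsPerm-shuffleId {n} {k} {β} β↭ σ∈ = begin
  _                                   ↭⟨ shuffle-↭ (idWord k) (map (_+ k) β) σ∈ ⟩
  idWord k ++ map (_+ k) β            ↭⟨ ↭ₚ.++⁺ˡ (idWord k) (↭ₚ.map⁺ (_+ k) β↭) ⟩
  idWord k ++ map (_+ k) (idWord n)   ≡⟨ cong (idWord k ++_) (map-+-range k 1 n) ⟩
  range 1 k ++ range (1 + k) n        ≡⟨ range-+ 1 k n ⟨
  idWord (k + n)                      ∎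
  where open ↭.PermutationReasoning

mcComp-shuffleId : ∀ k β {σ} → σ ∈ shuffleId k β → ∀ j → 1 ℕ.≤ j → mcComp σ (j + k) ≡ mcComp β j
mcComp-shuffleId k β {σ} σ∈ j 1≤j = cong₂ (λ u v → + u - + v) (shifted j 1≤j) (shifted (suc j) (ℕ.s≤s ℕ.z≤n))
  where
  shifted : ∀ i → 1 ℕ.≤ i → maj (subwordGe (i + k) σ) ≡ maj (subwordGe i β)
  shifted i 1≤i = begin
    maj (subwordGe (i + k) σ)                ≡⟨ cong maj (subwordGe-shuffle-idWord k (map (_+ k) β) (ℕₚ.+-monoˡ-≤ k 1≤i) σ∈) ⟩
    maj (subwordGe (i + k) (map (_+ k) β))   ≡⟨ cong maj (subwordGe-map-+ i k β) ⟩
    maj (map (_+ k) (subwordGe i β))         ≡⟨ majFrom-map-+ k 1 (subwordGe i β) ⟩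
    maj (subwordGe i β)                      ∎
    where open ≡-Reasoning

Mc-shuffleId : ∀ {n k β σ} → IsPerm n β → σ ∈ shuffleId k β → Mc σ ≡ mcPrefix k σ ++ Mc β
Mc-shuffleId {n} {k} {β} {σ} β↭ σ∈ = begin
  Mc σ                                                     ≡⟨ Mc-IsPerm (IsPerm-shuffleId β↭ σ∈) ⟩
  map (mcComp σ) (range 1 (k + n))                         ≡⟨ cong (map (mcComp σ)) (range-+ 1 k n) ⟩
  map (mcComp σ) (range 1 k ++ range (1 + k) n)            ≡⟨ Listₚ.map-++ (mcComp σ) (range 1 k) _ ⟩
  mcPrefix k σ ++ map (mcComp σ) (range (1 + k) n)         ≡⟨ cong (λ l → mcPrefix k σ ++ map (mcComp σ) l) (map-+-range k 1 n) ⟨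
  mcPrefix k σ ++ map (mcComp σ) (map (_+ k) (range 1 n))  ≡⟨ cong (mcPrefix k σ ++_) (Listₚ.map-∘ (range 1 n)) ⟨
  mcPrefix k σ ++ map (λ j → mcComp σ (j + k)) (range 1 n) ≡⟨ cong (mcPrefix k σ ++_) (Listₚ.map-cong-local shift) ⟩
  mcPrefix k σ ++ mcPrefix n β                             ≡⟨ cong (mcPrefix k σ ++_) (Mc-IsPerm β↭) ⟨
  mcPrefix k σ ++ Mc β                                     ∎
  where
  open ≡-Reasoning
  shift : All (λ j → mcComp σ (j + k) ≡ mcComp β j) (range 1 n)
  shift = All.map (mcComp-shuffleId k β σ∈ _) (range-all≥ 1 n)

mcComp-insert-max : ∀ m rp q {τ} → τ ∈ shuffle (idWord m) (reverse rp) → All (suc m ℕ.<_) (rp ++ q) →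
  mcComp (τ ++ suc m ∷ q) (suc m) ≡ + majIncrement rp q
mcComp-insert-max m rp q {τ} τ∈ x<rpq = begin
  + maj (subwordGe x (τ ++ x ∷ q)) - + maj (subwordGe (suc x) (τ ++ x ∷ q))
    ≡⟨ cong₂ (λ u v → + maj u - + maj v) with-x without-x ⟩
  + maj (reverse rp ++ x ∷ q) - + maj (reverse rp ++ q)
    ≡⟨ cong (λ u → + u - + maj (reverse rp ++ q)) (maj-insert-min rp x q (Allₚ.++⁺ x<rp x<q)) ⟩
  + (maj (reverse rp ++ q) + majIncrement rp q) - + maj (reverse rp ++ q)
    ≡⟨ +[m+n]-+m≡+n (maj (reverse rp ++ q)) (majIncrement rp q) ⟩
  + majIncrement rp q ∎
  where
  open ≡-Reasoning
  x = suc m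
  x<rp : All (x ℕ.<_) (reverse rp)
  x<rp = ↭ₚ.All-resp-↭ (↭.↭-sym (↭ₚ.↭-reverse rp)) (Allₚ.++⁻ˡ rp x<rpq)
  x<q : All (x ℕ.<_) q
  x<q = Allₚ.++⁻ʳ rp x<rpq
  with-x : subwordGe x (τ ++ x ∷ q) ≡ reverse rp ++ x ∷ q
  with-x = begin
    subwordGe x (τ ++ x ∷ q)               ≡⟨ Listₚ.filter-++ (x ≤?_) τ (x ∷ q) ⟩
    subwordGe x τ ++ subwordGe x (x ∷ q)   ≡⟨ cong₂ _++_
      (trans (subwordGe-shuffle-idWord m (reverse rp) ℕₚ.≤-refl τ∈) (Listₚ.filter-all (x ≤?_) (All.map ℕₚ.<⇒≤ x<rp)))
      (trans (Listₚ.filter-accept (x ≤?_) ℕₚ.≤-refl) (cong (x ∷_) (Listₚ.filter-all (x ≤?_) (All.map ℕₚ.<⇒≤ x<q)))) ⟩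
    reverse rp ++ x ∷ q                    ∎
  without-x : subwordGe (suc x) (τ ++ x ∷ q) ≡ reverse rp ++ q
  without-x = begin
    subwordGe (suc x) (τ ++ x ∷ q)                   ≡⟨ Listₚ.filter-++ (suc x ≤?_) τ (x ∷ q) ⟩
    subwordGe (suc x) τ ++ subwordGe (suc x) (x ∷ q) ≡⟨ cong₂ _++_
      (trans (subwordGe-shuffle-idWord m (reverse rp) (ℕₚ.m<n⇒m<1+n ℕₚ.≤-refl) τ∈) (Listₚ.filter-all (suc x ≤?_) x<rp))
      (trans (Listₚ.filter-reject (suc x ≤?_) (ℕₚ.<-irrefl refl)) (Listₚ.filter-all (suc x ≤?_) x<q)) ⟩
    reverse rp ++ q                                  ∎

mcPrefix-insert-max : ∀ m rp q {τ} → τ ∈ shuffle (idWord m) (reverse rp) → All (suc m ℕ.<_) (rp ++ q) →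
  mcPrefix (suc m) (τ ++ suc m ∷ q) ≡ mcPrefix m (τ ++ suc m ∷ q) ∷ʳ + majIncrement rp q
mcPrefix-insert-max m rp q {τ} τ∈ x<rpq = begin
  map (mcComp σ) (idWord (suc m))              ≡⟨ cong (map (mcComp σ)) (range-suc 1 m) ⟩
  map (mcComp σ) (idWord m ∷ʳ suc m)           ≡⟨ Listₚ.map-++ (mcComp σ) (idWord m) [ suc m ] ⟩
  mcPrefix m σ ∷ʳ mcComp σ (suc m)             ≡⟨ cong (mcPrefix m σ ∷ʳ_) (mcComp-insert-max m rp q τ∈ x<rpq) ⟩
  mcPrefix m σ ∷ʳ + majIncrement rp q          ∎
  where
  open ≡-Reasoning
  σ = τ ++ suc m ∷ q

private
  module ≈P = PermutationOf (↭.↭-setoid {A = ℤ})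
  module ≈Pₚ = PermutationOfₚ (↭.↭-setoid {A = ℤ})

mcPrefixes : ℕ → List ℕ → List (List ℕ) → List (List ℤ)
mcPrefixes m q = map (λ τ → mcPrefix m (τ ++ q))

mcPrefixes-map-∷ʳ : ∀ m b q S → mcPrefixes m q (map (_∷ʳ b) S) ≡ mcPrefixes m (b ∷ q) S
mcPrefixes-map-∷ʳ m b q S = trans (sym (Listₚ.map-∘ S))
  (Listₚ.map-cong (λ τ → cong (mcPrefix m) (Listₚ.++-assoc τ [ b ] q)) S)

mutual
  mcPrefixes-shuffle : ∀ m rp q → All (m ℕ.<_) (rp ++ q) →
    mcPrefixes m q (shuffle (idWord m) (reverse rp)) ≈ₘ multisets m (map (+_) (majIncrements rp q))
  mcPrefixes-shuffle zero rp q _ = ≈P.↭-refl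
  mcPrefixes-shuffle (suc m) rp q m<rpq = ≈P.↭-trans
    (≈P.↭-reflexive (cong (λ w → mcPrefixes (suc m) q (shuffle w (reverse rp))) (range-suc 1 m)))
    (mcPrefixes-shuffle-∷ʳ m rp q m<rpq)

  mcPrefixes-shuffle-∷ʳ : ∀ m rp q → All (suc m ℕ.<_) (rp ++ q) →
    mcPrefixes (suc m) q (shuffle (idWord m ∷ʳ suc m) (reverse rp)) ≈ₘ multisets (suc m) (map (+_) (majIncrements rp q))
  mcPrefixes-shuffle-∷ʳ m [] q x<q = begin
    mcPrefixes (suc m) q (shuffle (idWord m ∷ʳ suc m) [])
      ≡⟨ cong (mcPrefixes (suc m) q) (trans (shuffle-[]ʳ _) (cong (map (_∷ʳ suc m)) (sym (shuffle-[]ʳ (idWord m))))) ⟩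
    mcPrefixes (suc m) q (map (_∷ʳ suc m) (shuffle (idWord m) []))
      ↭⟨ mcPrefixes-max-last m [] q x<q ⟩
    map (+ majIncrement [] q ∷_) (multisets m [ + majIncrement [] q ])
      ≡⟨ Listₚ.++-identityʳ _ ⟨
    multisets (suc m) [ + majIncrement [] q ] ∎
    where open ≈P.PermutationReasoning
  mcPrefixes-shuffle-∷ʳ m (b ∷ rp) q x<brpq = begin
    P q (shuffle (idWord m ∷ʳ x) (reverse (b ∷ rp)))
      ≡⟨ cong (P q ∘ shuffle (idWord m ∷ʳ x)) (Listₚ.unfold-reverse b rp) ⟩
    P q (shuffle (idWord m ∷ʳ x) (reverse rp ∷ʳ b))
      ↭⟨ ↭.↭⇒↭ₛ′ ↭.↭-isEquivalence (↭ₚ.map⁺ _ (shuffle-∷ʳ (idWord m) (reverse rp) x b)) ⟩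
    P q (map (_∷ʳ x) S₁ ++ map (_∷ʳ b) S₂)
      ≡⟨ Listₚ.map-++ _ (map (_∷ʳ x) S₁) (map (_∷ʳ b) S₂) ⟩
    P q (map (_∷ʳ x) S₁) ++ P q (map (_∷ʳ b) S₂)
      ≡⟨ cong₂ _++_ (cong (P q ∘ map (_∷ʳ x) ∘ shuffle (idWord m)) (sym (Listₚ.unfold-reverse b rp)))
                    (mcPrefixes-map-∷ʳ (suc m) b q S₂) ⟩
    P q (map (_∷ʳ x) (shuffle (idWord m) (reverse (b ∷ rp)))) ++ P (b ∷ q) S₂
      ↭⟨ ≈Pₚ.++⁺ (mcPrefixes-max-last m (b ∷ rp) q x<brpq) (mcPrefixes-shuffle-∷ʳ m rp (b ∷ q) (move-b x<brpq)) ⟩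
    multisets (suc m) (map (+_) (majIncrements (b ∷ rp) q)) ∎
    where
    open ≈P.PermutationReasoning
    x = suc m
    P = mcPrefixes (suc m)
    S₁ = shuffle (idWord m) (reverse rp ∷ʳ b)
    S₂ = shuffle (idWord m ∷ʳ x) (reverse rp)
    move-b : All (x ℕ.<_) (b ∷ rp ++ q) → All (x ℕ.<_) (rp ++ b ∷ q)
    move-b (x<b ∷ x<rpq) = Allₚ.++⁺ (Allₚ.++⁻ˡ rp x<rpq) (x<b ∷ Allₚ.++⁻ʳ rp x<rpq)

  mcPrefixes-max-last : ∀ m rp q → All (suc m ℕ.<_) (rp ++ q) →
    mcPrefixes (suc m) q (map (_∷ʳ suc m) (shuffle (idWord m) (reverse rp))) ≈ₘ
    map (+ majIncrement rp q ∷_) (multisets m (map (+_) (majIncrements rp q)))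
  mcPrefixes-max-last m rp q x<rpq = begin
    mcPrefixes (suc m) q (map (_∷ʳ x) S)
      ≡⟨ mcPrefixes-map-∷ʳ (suc m) x q S ⟩
    mcPrefixes (suc m) (x ∷ q) S
      ↭⟨ map-≈ₘ-local _ _ S last-first ⟩
    map (λ τ → + δ ∷ mcPrefix m (τ ++ x ∷ q)) S
      ≡⟨ Listₚ.map-∘ S ⟩
    map (+ δ ∷_) (mcPrefixes m (x ∷ q) S)
      ↭⟨ map-∷-≈ₘ (+ δ) (mcPrefixes-shuffle m rp (x ∷ q) m<rpxq) ⟩
    map (+ δ ∷_) (multisets m (map (+_) (majIncrements rp (x ∷ q))))
      ↭⟨ map-∷-≈ₘ (+ δ) (multisets-↭ m (↭ₚ.map⁺ (+_) (majIncrements-∷-min rp x q x<rpq))) ⟩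
    map (+ δ ∷_) (multisets m (map (+_) (majIncrements rp q))) ∎
    where
    open ≈P.PermutationReasoning
    x = suc m
    δ = majIncrement rp q
    S = shuffle (idWord m) (reverse rp)
    last-first : ∀ {τ} → τ ∈ S → mcPrefix (suc m) (τ ++ x ∷ q) ↭ + δ ∷ mcPrefix m (τ ++ x ∷ q)
    last-first {τ} τ∈ = ↭.↭-trans (↭.↭-reflexive (mcPrefix-insert-max m rp q τ∈ x<rpq))
      (↭.↭-sym (↭ₚ.∷↭∷ʳ (+ δ) (mcPrefix m (τ ++ x ∷ q))))
    m<rpxq : All (m ℕ.<_) (rp ++ x ∷ q)
    m<rpxq = Allₚ.++⁺ (All.map ℕₚ.<⇒≤ (Allₚ.++⁻ˡ rp x<rpq)) (ℕₚ.≤-refl ∷ All.map ℕₚ.<⇒≤ (Allₚ.++⁻ʳ rp x<rpq))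

mcPrefixes-shuffleId : ∀ {n} k {β} → IsPerm n β →
  map (mcPrefix k) (shuffleId k β) ≈ₘ multisets k (map (+_) (range 0 (suc n)))
mcPrefixes-shuffleId {n} k {β} β↭ = begin
  map (mcPrefix k) (shuffle (idWord k) v)
    ≡⟨ Listₚ.map-cong (λ τ → cong (mcPrefix k) (Listₚ.++-identityʳ τ)) (shuffle (idWord k) v) ⟨
  mcPrefixes k [] (shuffle (idWord k) v)
    ≡⟨ cong (λ w → mcPrefixes k [] (shuffle (idWord k) w)) (Listₚ.reverse-involutive v) ⟨
  mcPrefixes k [] (shuffle (idWord k) (reverse (reverse v)))
    ↭⟨ mcPrefixes-shuffle k (reverse v) [] (Allₚ.++⁺ (↭ₚ.All-resp-↭ (↭.↭-sym (↭ₚ.↭-reverse v)) k<v) []) ⟩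
  multisets k (map (+_) (majIncrements (reverse v) []))
    ↭⟨ multisets-↭ k (↭ₚ.map⁺ (+_) (majIncrements-[] (reverse v))) ⟩
  multisets k (map (+_) (range 0 (suc (length (reverse v)))))
    ≡⟨ cong (λ l → multisets k (map (+_) (range 0 (suc l)))) |v|≡n ⟩
  multisets k (map (+_) (range 0 (suc n))) ∎
  where
  open ≈P.PermutationReasoning
  v = map (ℕ._+ k) β
  k<v : All (k ℕ.<_) v
  k<v = Allₚ.map⁺ (All.map (ℕₚ.+-monoˡ-≤ k) (↭ₚ.All-resp-↭ (↭.↭-sym β↭) (range-all≥ 1 n)))
  |v|≡n : length (reverse v) ≡ n
  |v|≡n = trans (Listₚ.length-reverse v) (trans (Listₚ.length-map (ℕ._+ k) β) (IsPerm-length β↭))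

take-length-++ : ∀ {A : Set} (xs ys : List A) → take (length xs) (xs ++ ys) ≡ xs
take-length-++ [] ys = refl
take-length-++ (x ∷ xs) ys = cong (x ∷_) (take-length-++ xs ys)

take-Mc-shuffleId : ∀ {n k β σ} → IsPerm n β → σ ∈ shuffleId k β → take k (Mc σ) ≡ mcPrefix k σ
take-Mc-shuffleId {k = k} {β} {σ} β↭ σ∈ = begin
  take k (Mc σ)                     ≡⟨ cong (take k) (Mc-shuffleId β↭ σ∈) ⟩
  take k (mcPrefix k σ ++ Mc β)     ≡⟨ cong (λ l → take l (mcPrefix k σ ++ Mc β)) |mcPrefix|≡k ⟨
  take (length (mcPrefix k σ)) (mcPrefix k σ ++ Mc β) ≡⟨ take-length-++ (mcPrefix k σ) (Mc β) ⟩
  mcPrefix k σ                      ∎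
  where
  open ≡-Reasoning
  |mcPrefix|≡k = trans (Listₚ.length-map (mcComp σ) (idWord k)) (length-range 1 k)

sortedPrefix⇒bounded : ∀ {n k β s} → IsPerm n β →
  (∃ λ σ → σ ∈ shuffleId k β × IsNondecRearrangement s (take k (Mc σ))) →
  length s ≡ k × NonDecreasing s × All (λ i → + 0 ≤ i × i ≤ + n) s
sortedPrefix⇒bounded {k = k} {s = s} β↭ (σ , σ∈ , s↑ , s↭)
  with ∈-resp-≈ₘ (mcPrefixes-shuffleId k β↭) (∈ₚ.∈-map⁺ (mcPrefix k) σ∈)
... | y , y∈ , σ↭y with ∈-multisets⁻ k _ y∈
...   | |y|≡k , y⊆ = trans (↭ₚ.↭-length s↭y) |y|≡k , s↑ , ↭ₚ.All-resp-↭ (↭.↭-sym s↭y) (All.map ∈-ints⁻ y⊆)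
  where
  s↭y : s ↭ y
  s↭y = ↭.↭-trans (subst (s ↭_) (take-Mc-shuffleId β↭ σ∈) s↭) σ↭y

bounded⇒sortedPrefix : ∀ {n k β s} → IsPerm n β →
  length s ≡ k × NonDecreasing s × All (λ i → + 0 ≤ i × i ≤ + n) s →
  ∃ λ σ → σ ∈ shuffleId k β × IsNondecRearrangement s (take k (Mc σ))
bounded⇒sortedPrefix {n} {k} {s = s} β↭ (refl , s↑ , s-bounds)
  with ∈-resp-≈ₘ (≈P.↭-sym (mcPrefixes-shuffleId k β↭))
         (∈-multisets⁺ _ s (ints-increasing n) s↑ (All.map (λ (0≤i , i≤n) → ∈-ints⁺ 0≤i i≤n) s-bounds))
... | c , c∈ , s↭c with ∈ₚ.∈-map⁻ (mcPrefix k) c∈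
...   | σ , σ∈ , refl = σ , σ∈ , s↑ , subst (s ↭_) (sym (take-Mc-shuffleId β↭ σ∈)) s↭c

shuffleSum≈hPoly*Mc : ∀ {n} k {β} → IsPerm n β → shuffleSum k β ≈P (hPoly k n *M Mc β)
shuffleSum≈hPoly*Mc {n} k {β} β↭ = begin
  map Mc (shuffleId k β)
    ≡⟨ Listₚ.map-cong-local (All.tabulate (Mc-shuffleId β↭)) ⟩
  map (λ σ → mcPrefix k σ ++ Mc β) (shuffleId k β)
    ≡⟨ Listₚ.map-∘ (shuffleId k β) ⟩
  map (_++ Mc β) (map (mcPrefix k) (shuffleId k β))
    ↭⟨ ≈Pₚ.map⁺ (↭.↭-setoid {A = ℤ}) (↭ₚ.++⁺ʳ (Mc β)) (mcPrefixes-shuffleId k β↭) ⟩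
  map (_++ Mc β) (multisets k (map (+_) (range 0 (suc n))))
    ≡⟨ cong (map (_++ Mc β)) (hPoly-multisets k n) ⟨
  hPoly k n *M Mc β ∎
  where open ≈P.PermutationReasoning

mainTheorem14 : (n k : ℕ) (β : List ℕ) → IsPerm n β → k ≥ 1 →
    ((s : List ℤ) →
      (∃ λ σ → σ ∈ shuffleId k β × IsNondecRearrangement s (take k (Mc σ)))
      ⇔ (length s ≡ k × NonDecreasing s × All (λ i → + 0 ≤ i × i ≤ + n) s))
    × (shuffleSum k β ≈P (hPoly k n *M Mc β))
mainTheorem14 n k β β↭ _ =
  (λ s → mk⇔ (sortedPrefix⇒bounded β↭) (bounded⇒sortedPrefix β↭)) , shuffleSum≈hPoly*Mc k β↭
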